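{- Let $k$ and $n$ be positive integers. If $H$ is a $k$-uniform hypergraph on $n$ vertices with at least $m = n 2^k$ edges, then there exists an unsatisfiable $k$-CNF formula $F$ inducing $H$.
   Context: A $k$-uniform hypergraph has every edge consisting of exactly $k$ vertices. A $k$-CNF formula is a conjunction of clauses, each a disjunction of exactly $k$ literals over $k$ distinct Boolean variables. A $k$-CNF formula $F$ induces the hypergraph $G_F$ whose vertices are the variables of $F$ and which has, for each clause of $F$, one edge consisting of the variables of that clause (so clauses correspond one-to-one with edges). "$F$ induces $H$" means $G_F$ equals $H$ under an identification of variables with vertices. -}

module Defs where

open import Data.Nat using (ℕ)
open import Data.Bool using (Bool; true; false; not; _∨_; _∧_)
open import Data.Fin using (Fin)
open import Data.Fin.Subset using (Subset; ∣_∣; ⁅_⁆; _∪_; ⊥)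
open import Data.Product using (_×_; _,_; proj₁; proj₂; Σ; ∃)
open import Data.List using (List; []; _∷_; map; length; foldr)
open import Data.List.Relation.Unary.All using (All)
open import Data.List.Relation.Unary.Unique.Propositional using (Unique)
open import Data.List.Relation.Binary.Permutation.Propositional using (_↭_)
open import Relation.Binary.PropositionalEquality using (_≡_)
open import Relation.Nullary using (¬_)

record Hypergraph (k n : ℕ) : Set where
  field
    edges    : List (Subset n)
    uniform  : All (λ e → ∣ e ∣ ≡ k) edges
    distinct : Unique edges
open Hypergraph public

-- Literal over variables Fin n: a variable with a polarity
-- (true = positive literal x, false = negated literal ¬x).
Literal : ℕ → Set
Literal n = Fin n × Bool

var : ∀ {n} → Literal n → Fin n
var = proj₁

Clause : ℕ → Set
Clause n = List (Literal n)

CNF : ℕ → Set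
CNF n = List (Clause n)

IsKClause : ∀ {n} → ℕ → Clause n → Set
IsKClause k C = length C ≡ k × Unique (map var C)

IsKCNF : ∀ {n} → ℕ → CNF n → Set
IsKCNF k F = All (IsKClause k) F

Assignment : ℕ → Set
Assignment n = Fin n → Bool

evalLit : ∀ {n} → Assignment n → Literal n → Bool
evalLit α (x , true)  = α x
evalLit α (x , false) = not (α x)

evalClause : ∀ {n} → Assignment n → Clause n → Bool
evalClause α C = foldr (λ l b → evalLit α l ∨ b) false C

evalCNF : ∀ {n} → Assignment n → CNF n → Bool
evalCNF α F = foldr (λ C b → evalClause α C ∧ b) true F

Satisfiable : ∀ {n} → CNF n → Set
Satisfiable F = ∃ λ α → evalCNF α F ≡ true

Unsatisfiable : ∀ {n} → CNF n → Set
Unsatisfiable F = ¬ Satisfiable F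

varSet : ∀ {n} → Clause n → Subset n
varSet C = foldr (λ l s → ⁅ var l ⁆ ∪ s) ⊥ C

inducedEdges : ∀ {n} → CNF n → List (Subset n)
inducedEdges F = map varSet F

-- F induces H: the clauses of F correspond one-to-one with the edges of H,
-- each clause having exactly the variables of its edge
-- (variables of F identified with the vertices Fin n of H).
Induces : ∀ {k n} → CNF n → Hypergraph k n → Set
Induces F H = inducedEdges F ↭ edges H

module Submission where

open import Defs
open import Data.Nat using (ℕ; suc; _*_; _^_; _≤_)
open import Data.List using (length)
open import Data.Product using (Σ; _×_)

-- Proof idea (a greedy, "method of conditional expectations" argument).
-- Process the edges of H one at a time while keeping track of the set S of
-- assignments that satisfy all clauses chosen so far.  For an edge e with
-- |e| = k, choose the polarities of its variables one by one, each time taking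
-- the literal that is false on at least half of the currently considered
-- assignments; the resulting clause is falsified by at least |S|/2^k of S.
-- Writing K = 2^k = j + 1, the surviving set therefore satisfies
-- K·|S'| ≤ j·|S|, and after m edges K^m·|S_m| ≤ j^m·2^n.  A Bernoulli-type
-- estimate gives 2·j^K < K^K, i.e. (1 - 1/K)^K < 1/2, whence j^m·2^n < K^m as
-- soon as m ≥ n·K, forcing |S_m| = 0: the greedy formula is unsatisfiable.

open import Data.Nat using (zero; _+_; _<_; z≤n; s≤s; pred; >-nonZero)
open import Data.Nat.Properties hiding (suc-injective)
open import Data.Nat.Tactic.RingSolver using (solve-∀)
open import Data.Bool using (Bool; true; false; not; _∧_; _∨_; if_then_else_)
open import Data.Bool.Properties using (∧-assoc; ∧-identityʳ; ∨-∧-booleanAlgebra)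
open import Algebra.Lattice.Properties.BooleanAlgebra ∨-∧-booleanAlgebra using (deMorgan₂)
open import Data.Fin using (Fin; zero; suc)
open import Data.Fin.Properties using (suc-injective)
open import Data.Fin.Subset using (Subset; ∣_∣; ⁅_⁆; _∪_; ⊥)
open import Data.Fin.Subset.Properties using (∪-identityˡ)
open import Data.Vec using (Vec; []; _∷_; lookup; tabulate)
open import Data.Vec.Properties using (lookup∘tabulate)
open import Data.List using (List; []; _∷_; map; foldr; _++_)
open import Data.List.Properties using (length-map; length-++; foldr-map)
open import Data.List.Relation.Unary.All using (All; []; _∷_; universal)
import Data.List.Relation.Unary.All.Properties as All
open import Data.List.Relation.Unary.Any using (here; there)
open import Data.List.Membership.Propositional using (_∈_)
open import Data.List.Membership.Propositional.Properties using (∈-++⁺ˡ; ∈-++⁺ʳ; ∈-map⁺)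
open import Data.List.Relation.Unary.Unique.Propositional using (Unique; []; _∷_)
import Data.List.Relation.Unary.Unique.Propositional.Properties as Unique
open import Data.List.Relation.Binary.Permutation.Propositional using (↭-reflexive)
open import Data.Product using (_,_; proj₁; proj₂)
open import Data.Sum using (_⊎_; inj₁; inj₂)
open import Function using (_∘_)
open import Relation.Binary.PropositionalEquality
open import Relation.Nullary using (contradiction)

-- Arithmetic estimates

-- The first two binomial terms of (a+1)^(m+1) already bound it from below.
bernoulli : ∀ a m → a ^ suc m + suc m * a ^ m ≤ suc a ^ suc m
bernoulli a zero = ≤-reflexive (+-comm (a * 1) 1)
bernoulli a (suc m) = begin
  a ^ suc (suc m) + suc (suc m) * a ^ suc m
    ≤⟨ m≤m+n _ (suc m * a ^ m) ⟩
  a ^ suc (suc m) + suc (suc m) * a ^ suc m + suc m * a ^ m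
    ≡⟨ expand a m (a ^ m) ⟩
  suc a * (a ^ suc m + suc m * a ^ m)
    ≤⟨ *-monoʳ-≤ (suc a) (bernoulli a m) ⟩
  suc a ^ suc (suc m) ∎
  where
  open ≤-Reasoning
  expand : ∀ a m x → a * (a * x) + suc (suc m) * (a * x) + suc m * x ≡ suc a * (a * x + suc m * x)
  expand = solve-∀

-- a^a is positive (including 0^0 = 1).
self-power-pos : ∀ a → 0 < a ^ a
self-power-pos zero = s≤s z≤n
self-power-pos (suc a) = m^n>0 (suc a) (suc a)

-- With K = a+1: 2·a^K < K^K, the integer form of (1 - 1/K)^K < 1/2.
half-power : ∀ a → 2 * a ^ suc a < suc a ^ suc a
half-power a = begin-strict
  2 * a ^ suc a             ≡⟨ cong (a ^ suc a +_) (+-identityʳ (a ^ suc a)) ⟩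
  a ^ suc a + a * a ^ a     <⟨ +-monoʳ-< (a ^ suc a) (m<n+m (a * a ^ a) (self-power-pos a)) ⟩
  a ^ suc a + suc a * a ^ a ≤⟨ bernoulli a a ⟩
  suc a ^ suc a             ∎
  where open ≤-Reasoning

^-distribʳ-* : ∀ x y n → (x * y) ^ n ≡ x ^ n * y ^ n
^-distribʳ-* x y zero = refl
^-distribʳ-* x y (suc n) = begin
  x * y * (x * y) ^ n     ≡⟨ cong (x * y *_) (^-distribʳ-* x y n) ⟩
  x * y * (x ^ n * y ^ n) ≡⟨ interchange x y (x ^ n) (y ^ n) ⟩
  x * x ^ n * (y * y ^ n) ∎
  where
  open ≡-Reasoning
  interchange : ∀ a b c d → a * b * (c * d) ≡ a * c * (b * d)
  interchange = solve-∀

*-mono-<-≤ : ∀ {a b c d} → a < b → c ≤ d → 0 < d → a * c < b * d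
*-mono-<-≤ {a} {b} {c} {d} a<b c≤d 0<d =
  ≤-<-trans (*-monoʳ-≤ a c≤d) (*-monoˡ-< d {{>-nonZero 0<d}} a<b)

block-decay : ∀ a n → 0 < n → 2 ^ n * a ^ (suc a * n) < suc a ^ (suc a * n)
block-decay a n 0<n = begin-strict
  2 ^ n * a ^ (suc a * n) ≡⟨ cong (2 ^ n *_) (sym (^-*-assoc a (suc a) n)) ⟩
  2 ^ n * (a ^ suc a) ^ n ≡⟨ sym (^-distribʳ-* 2 (a ^ suc a) n) ⟩
  (2 * a ^ suc a) ^ n     <⟨ ^-monoˡ-< n {{>-nonZero 0<n}} (half-power a) ⟩
  (suc a ^ suc a) ^ n     ≡⟨ ^-*-assoc (suc a) (suc a) n ⟩
  suc a ^ (suc a * n)     ∎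
  where open ≤-Reasoning

-- The same holds for every m ≥ n·K, since a^r ≤ K^r for the excess r.
decay : ∀ a n m → 0 < n → n * suc a ≤ m → a ^ m * 2 ^ n < suc a ^ m
decay a n m 0<n nK≤m with m≤n⇒∃[o]m+o≡n nK≤m
... | r , refl = begin-strict
  a ^ (n * K + r) * 2 ^ n       ≡⟨ cong (λ e → a ^ (e + r) * 2 ^ n) (*-comm n K) ⟩
  a ^ (K * n + r) * 2 ^ n       ≡⟨ cong (_* 2 ^ n) (^-distribˡ-+-* a (K * n) r) ⟩
  a ^ (K * n) * a ^ r * 2 ^ n   ≡⟨ rotate (a ^ (K * n)) (a ^ r) (2 ^ n) ⟩
  2 ^ n * a ^ (K * n) * a ^ r   <⟨ *-mono-<-≤ (block-decay a n 0<n) (^-monoˡ-≤ r (n≤1+n a)) (m^n>0 K r) ⟩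
  K ^ (K * n) * K ^ r           ≡⟨ sym (^-distribˡ-+-* K (K * n) r) ⟩
  K ^ (K * n + r)               ≡⟨ cong (λ e → K ^ (e + r)) (*-comm K n) ⟩
  K ^ (n * K + r)               ∎
  where
  open ≤-Reasoning
  K = suc a
  rotate : ∀ x y z → x * y * z ≡ z * x * y
  rotate = solve-∀

-- One greedy step: if d of the c live assignments are killed, c' survive and
-- c ≤ K·d with K = j+1, then K·c' ≤ j·c.
shrink : ∀ j {c c' d} → c' + d ≡ c → c ≤ suc j * d → suc j * c' ≤ j * c
shrink j {c} {c'} {d} split c≤Kd = +-cancelʳ-≤ c (suc j * c') (j * c) (begin
  suc j * c' + c          ≤⟨ +-monoʳ-≤ (suc j * c') c≤Kd ⟩
  suc j * c' + suc j * d  ≡⟨ sym (*-distribˡ-+ (suc j) c' d) ⟩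
  suc j * (c' + d)        ≡⟨ cong (suc j *_) split ⟩
  c + j * c               ≡⟨ +-comm c (j * c) ⟩
  j * c + c               ∎)
  where open ≤-Reasoning

shrink-iterate : ∀ K j m {x c' c} → K ^ m * x ≤ j ^ m * c' → K * c' ≤ j * c →
  K ^ suc m * x ≤ j ^ suc m * c
shrink-iterate K j m {x} {c'} {c} later first = begin
  K * K ^ m * x     ≡⟨ *-assoc K (K ^ m) x ⟩
  K * (K ^ m * x)   ≤⟨ *-monoʳ-≤ K later ⟩
  K * (j ^ m * c')  ≡⟨ swap K (j ^ m) c' ⟩
  j ^ m * (K * c')  ≤⟨ *-monoʳ-≤ (j ^ m) first ⟩
  j ^ m * (j * c)   ≡⟨ sym (trans (*-assoc j (j ^ m) c) (swap j (j ^ m) c)) ⟩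
  j * j ^ m * c     ∎
  where
  open ≤-Reasoning
  swap : ∀ x y z → x * (y * z) ≡ y * (x * z)
  swap = solve-∀

vanish : ∀ {x y c} → x * c ≤ y → y < x → c ≡ 0
vanish {c = zero} _ _ = refl
vanish {x} {y} {suc c} xc≤y y<x =
  contradiction (≤-trans (m≤m*n x (suc c)) xc≤y) (<⇒≱ y<x)

larger-half : ∀ {a b c} → a + b ≡ c → c ≤ 2 * a ⊎ c ≤ 2 * b
larger-half {a} {b} refl with ≤-total a b
... | inj₁ a≤b = inj₂ (≤-trans (+-monoˡ-≤ b a≤b) (≤-reflexive (cong (b +_) (sym (+-identityʳ b)))))
... | inj₂ b≤a = inj₁ (≤-trans (+-monoʳ-≤ a b≤a) (≤-reflexive (cong (a +_) (sym (+-identityʳ a)))))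

-- Counting the elements of a list satisfying a boolean predicate

count : ∀ {A : Set} → (A → Bool) → List A → ℕ
count p [] = 0
count p (x ∷ xs) = if p x then suc (count p xs) else count p xs

infixr 6 _&_
_&_ : ∀ {A : Set} → (A → Bool) → (A → Bool) → A → Bool
(p & q) x = p x ∧ q x

count-cong : ∀ {A : Set} {p q : A → Bool} → (∀ x → p x ≡ q x) → ∀ xs → count p xs ≡ count q xs
count-cong p≗q [] = refl
count-cong p≗q (x ∷ xs) rewrite p≗q x | count-cong p≗q xs = refl

count-split : ∀ {A : Set} (p q : A → Bool) xs →
  count (p & q) xs + count (p & (not ∘ q)) xs ≡ count p xs
count-split p q [] = refl
count-split p q (x ∷ xs) with p x | q x
... | false | _     = count-split p q xs
... | true  | true  = cong suc (count-split p q xs)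
... | true  | false = trans (+-suc _ _) (cong suc (count-split p q xs))

count-length : ∀ {A : Set} (xs : List A) → count (λ _ → true) xs ≡ length xs
count-length [] = refl
count-length (x ∷ xs) = cong suc (count-length xs)

count-pos : ∀ {A : Set} {p : A → Bool} {x xs} → x ∈ xs → p x ≡ true → 0 < count p xs
count-pos {p = p} {xs = y ∷ ys} (here refl) px rewrite px = s≤s z≤n
count-pos {p = p} {xs = y ∷ ys} (there x∈ys) px with p y
... | true  = s≤s z≤n
... | false = count-pos x∈ys px

-- Subsets of Fin n as duplicate-free lists of vertices

elements : ∀ {n} → Subset n → List (Fin n)
elements []          = []
elements (true ∷ e)  = zero ∷ map suc (elements e)
elements (false ∷ e) = map suc (elements e)

⋃ : ∀ {n} → List (Fin n) → Subset n
⋃ = foldr (λ x s → ⁅ x ⁆ ∪ s) ⊥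

⋃-map-suc : ∀ {n} (xs : List (Fin n)) → ⋃ (map suc xs) ≡ false ∷ ⋃ xs
⋃-map-suc [] = refl
⋃-map-suc (x ∷ xs) = cong (⁅ suc x ⁆ ∪_) (⋃-map-suc xs)

⋃-elements : ∀ {n} (e : Subset n) → ⋃ (elements e) ≡ e
⋃-elements [] = refl
⋃-elements (true ∷ e) rewrite ⋃-map-suc (elements e) | ⋃-elements e = cong (true ∷_) (∪-identityˡ e)
⋃-elements (false ∷ e) rewrite ⋃-map-suc (elements e) | ⋃-elements e = refl

length-elements : ∀ {n} (e : Subset n) → length (elements e) ≡ ∣ e ∣
length-elements [] = refl
length-elements (true ∷ e) = cong suc (trans (length-map suc (elements e)) (length-elements e))
length-elements (false ∷ e) = trans (length-map suc (elements e)) (length-elements e)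

elements-unique : ∀ {n} (e : Subset n) → Unique (elements e)
elements-unique [] = []
elements-unique (true ∷ e) =
  All.map⁺ (universal (λ _ ()) (elements e)) ∷ Unique.map⁺ suc-injective (elements-unique e)
elements-unique (false ∷ e) = Unique.map⁺ suc-injective (elements-unique e)

-- Clauses over the vertices of an edge

varSet-elements : ∀ {n} {C : Clause n} (e : Subset n) → map var C ≡ elements e → varSet C ≡ e
varSet-elements {C = C} e vars = begin
  varSet C                              ≡⟨ sym (foldr-map (λ x s → ⁅ x ⁆ ∪ s) var ⊥ C) ⟩
  ⋃ (map var C)                         ≡⟨ cong ⋃ vars ⟩
  ⋃ (elements e)                        ≡⟨ ⋃-elements e ⟩
  e                                     ∎
  where open ≡-Reasoning

isKClause-elements : ∀ {n k} {C : Clause n} (e : Subset n) → map var C ≡ elements e →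
  ∣ e ∣ ≡ k → IsKClause k C
isKClause-elements {C = C} e vars ∣e∣≡k =
  trans (sym (length-map var C)) (trans (cong length vars) (trans (length-elements e) ∣e∣≡k)) ,
  subst Unique (sym vars) (elements-unique e)

-- Evaluation on assignment vectors

evalLit-cong : ∀ {n} {α β : Assignment n} → (∀ x → α x ≡ β x) → ∀ l → evalLit α l ≡ evalLit β l
evalLit-cong α≗β (x , true)  = α≗β x
evalLit-cong α≗β (x , false) = cong not (α≗β x)

evalClause-cong : ∀ {n} {α β : Assignment n} → (∀ x → α x ≡ β x) → ∀ C → evalClause α C ≡ evalClause β C
evalClause-cong α≗β [] = refl
evalClause-cong α≗β (l ∷ C) = cong₂ _∨_ (evalLit-cong α≗β l) (evalClause-cong α≗β C)

evalCNF-cong : ∀ {n} {α β : Assignment n} → (∀ x → α x ≡ β x) → ∀ F → evalCNF α F ≡ evalCNF β F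
evalCNF-cong α≗β [] = refl
evalCNF-cong α≗β (C ∷ F) = cong₂ _∧_ (evalClause-cong α≗β C) (evalCNF-cong α≗β F)

-- Assignments are enumerated as boolean vectors v, read as `lookup v`.
Point : ℕ → Set
Point n = Vec Bool n

litFalse : ∀ {n} → Literal n → Point n → Bool
litFalse l v = not (evalLit (lookup v) l)

satisfies : ∀ {n} → Clause n → Point n → Bool
satisfies C v = evalClause (lookup v) C

falsifies : ∀ {n} → Clause n → Point n → Bool
falsifies C v = not (satisfies C v)

models : ∀ {n} → CNF n → Point n → Bool
models F v = evalCNF (lookup v) F

falsifies-∷ : ∀ {n} (l : Literal n) C v → falsifies (l ∷ C) v ≡ litFalse l v ∧ falsifies C v
falsifies-∷ l C v = deMorgan₂ (evalLit (lookup v) l) (satisfies C v)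

-- The greedy construction, relative to a fixed list U of assignments

module Greedy {n : ℕ} (U : List (Point n)) where

  size : (Point n → Bool) → ℕ
  size S = count S U

  bestLiteral : (S : Point n → Bool) (x : Fin n) →
    Σ Bool λ s → size S ≤ 2 * size (S & litFalse (x , s))
  bestLiteral S x
    with larger-half {size (S & litFalse (x , true))} {size (S & litFalse (x , false))}
                     (count-split S (litFalse (x , true)) U)
  ... | inj₁ half = true , half
  ... | inj₂ half = false , half

  bestClause : (S : Point n → Bool) (xs : List (Fin n)) →
    Σ (Clause n) λ C → map var C ≡ xs × size S ≤ 2 ^ length xs * size (S & falsifies C)
  bestClause S [] =
    [] , refl , ≤-reflexive (trans (count-cong (λ v → sym (∧-identityʳ (S v))) U) (sym (*-identityˡ _)))
  bestClause S (x ∷ xs) =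
    (x , s) ∷ C , cong (x ∷_) vars , (begin
      size S                                      ≤⟨ half ⟩
      2 * size S'                                 ≤⟨ *-monoʳ-≤ 2 bound ⟩
      2 * (2 ^ length xs * size (S' & falsifies C)) ≡⟨ sym (*-assoc 2 (2 ^ length xs) _) ⟩
      2 ^ suc (length xs) * size (S' & falsifies C) ≡⟨ cong (2 ^ suc (length xs) *_) (count-cong regroup U) ⟩
      2 ^ suc (length xs) * size (S & falsifies ((x , s) ∷ C)) ∎)
    where
    open ≤-Reasoning
    s = proj₁ (bestLiteral S x)
    half = proj₂ (bestLiteral S x)
    S' = S & litFalse (x , s)
    C = proj₁ (bestClause S' xs)
    vars = proj₁ (proj₂ (bestClause S' xs))
    bound = proj₂ (proj₂ (bestClause S' xs))
    regroup : ∀ v → (S' & falsifies C) v ≡ (S & falsifies ((x , s) ∷ C)) v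
    regroup v = trans (∧-assoc (S v) _ _) (cong (S v ∧_) (sym (falsifies-∷ (x , s) C v)))

  clauseFor : Subset n → (Point n → Bool) → Clause n
  clauseFor e S = proj₁ (bestClause S (elements e))

  greedy : List (Subset n) → (Point n → Bool) → CNF n
  greedy []       S = []
  greedy (e ∷ es) S = clauseFor e S ∷ greedy es (S & satisfies (clauseFor e S))

  greedy-induces : ∀ es S → inducedEdges (greedy es S) ≡ es
  greedy-induces []       S = refl
  greedy-induces (e ∷ es) S =
    cong₂ _∷_ (varSet-elements e (proj₁ (proj₂ (bestClause S (elements e))))) (greedy-induces es _)

  greedy-isKCNF : ∀ {k} es → All (λ e → ∣ e ∣ ≡ k) es → ∀ S → IsKCNF k (greedy es S)
  greedy-isKCNF []       []             S = []
  greedy-isKCNF (e ∷ es) (∣e∣≡k ∷ uni) S =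
    isKClause-elements e (proj₁ (proj₂ (bestClause S (elements e)))) ∣e∣≡k ∷ greedy-isKCNF es uni _

  greedy-decay : ∀ {k j} → 2 ^ k ≡ suc j → ∀ es → All (λ e → ∣ e ∣ ≡ k) es → ∀ S →
    suc j ^ length es * size (S & models (greedy es S)) ≤ j ^ length es * size S
  greedy-decay _ [] [] S =
    ≤-reflexive (trans (*-identityˡ _) (trans (count-cong (λ v → ∧-identityʳ (S v)) U) (sym (*-identityˡ _))))
  greedy-decay {j = j} K≡ (e ∷ es) (∣e∣≡k ∷ uni) S =
    shrink-iterate (suc j) j (length es) later (shrink j split first)
    where
    C = clauseFor e S
    S' = S & satisfies C
    later : suc j ^ length es * size (S & models (greedy (e ∷ es) S)) ≤ j ^ length es * size S'
    later = subst (λ z → suc j ^ length es * z ≤ j ^ length es * size S')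
              (count-cong (λ v → ∧-assoc (S v) _ _) U) (greedy-decay K≡ es uni S')
    split : size S' + size (S & falsifies C) ≡ size S
    split = count-split S (satisfies C) U
    first : size S ≤ suc j * size (S & falsifies C)
    first = subst (λ K → size S ≤ K * size (S & falsifies C))
              (trans (cong (2 ^_) (trans (length-elements e) ∣e∣≡k)) K≡)
              (proj₂ (proj₂ (bestClause S (elements e))))

allPoints : ∀ n → List (Point n)
allPoints zero    = [] ∷ []
allPoints (suc n) = map (true ∷_) (allPoints n) ++ map (false ∷_) (allPoints n)

length-allPoints : ∀ n → length (allPoints n) ≡ 2 ^ n
length-allPoints zero = refl
length-allPoints (suc n) = begin
  length (map (true ∷_) (allPoints n) ++ map (false ∷_) (allPoints n))
    ≡⟨ length-++ (map (true ∷_) (allPoints n)) ⟩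
  length (map (true ∷_) (allPoints n)) + length (map (false ∷_) (allPoints n))
    ≡⟨ cong₂ _+_ (length-map _ (allPoints n)) (length-map _ (allPoints n)) ⟩
  length (allPoints n) + length (allPoints n)
    ≡⟨ cong₂ _+_ (length-allPoints n) (trans (length-allPoints n) (sym (+-identityʳ _))) ⟩
  2 ^ suc n ∎
  where open ≡-Reasoning

∈-allPoints : ∀ {n} (v : Point n) → v ∈ allPoints n
∈-allPoints []          = here refl
∈-allPoints (true ∷ v)  = ∈-++⁺ˡ (∈-map⁺ (true ∷_) (∈-allPoints v))
∈-allPoints (false ∷ v) = ∈-++⁺ʳ (map (true ∷_) (allPoints _)) (∈-map⁺ (false ∷_) (∈-allPoints v))

lemma3 : (k n : ℕ) → 1 ≤ k → 1 ≤ n → (H : Hypergraph k n) →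
    n * 2 ^ k ≤ length (edges H) →
    Σ (CNF n) (λ F → IsKCNF k F × Induces F H × Unsatisfiable F)
-- (The argument does not need the hypothesis 1 ≤ k.)
lemma3 k n _ 0<n H nK≤m =
  F , greedy-isKCNF (edges H) (uniform H) everything
    , ↭-reflexive (greedy-induces (edges H) everything)
    , unsatisfiable
  where
  open Greedy (allPoints n)
  everything : Point n → Bool
  everything _ = true
  F = greedy (edges H) everything
  m = length (edges H)
  j = pred (2 ^ k)
  K≡ : 2 ^ k ≡ suc j
  K≡ = sym (suc-pred (2 ^ k) {{m^n≢0 2 k}})
  size-everything : size everything ≡ 2 ^ n
  size-everything = trans (count-length (allPoints n)) (length-allPoints n)
  no-model : size (models F) ≡ 0
  no-model = vanish (greedy-decay K≡ (edges H) (uniform H) everything)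
    (subst (λ N → j ^ m * N < suc j ^ m) (sym size-everything)
      (decay j n m 0<n (subst (λ K → n * K ≤ m) K≡ nK≤m)))
  unsatisfiable : Unsatisfiable F
  unsatisfiable (α , α⊨F) = contradiction no-model (>⇒≢
    (count-pos (∈-allPoints (tabulate α))
      (trans (evalCNF-cong (lookup∘tabulate α) F) α⊨F)))
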